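{- Let $X\in\mathsf{PreOrd}_n$. Then the cost of \textsc{Greedy} on $X$ run without initial tree satisfies $\textsc{Greedy}(X)\le 4n$.
   Context: $\mathsf{PreOrd}_n$: a permutation sequence $X=(x_1,\dots,x_n)$ belongs to $\mathsf{PreOrd}_n$ if $n=1$, or there is $n'<n$ such that $(x_2,\dots,x_{n'})\in\mathsf{PreOrd}_{n'-1}$ and $(x_{n'+1},\dots,x_n)\in\mathsf{PreOrd}_{n-n'}$ (each up to order-isomorphism, as sequences of distinct keys), and every element of $(x_2,\dots,x_{n'})$ is smaller than $x_1$, which is smaller than every element of $(x_{n'+1},\dots,x_n)$. (These are the preorder sequences of BSTs.) Geometric model: $X$ gives access points $(x_t,t)$. \textsc{Greedy} without initial tree: let $\tau(b,t)$ be the latest time $\le t$ with an output point in column $b$; at time $t$ with access $(a,t)$, add $(a,t)$ and $(b,t)$ for every $b\ne a$ with $\tau(b,t-1)$ defined such that the closed rectangle with corners $(a,t),(b,\tau(b,t-1))$ contains no output point at times $<t$ other than $(b,\tau(b,t-1))$. $\textsc{Greedy}(X)$ denotes the number of output points. -}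

module Defs where

open import Data.Nat using (ℕ; zero; suc; _+_; _*_; _<_; _≤ᵇ_; _≡ᵇ_)
open import Data.Nat.Properties using (_≟_)
open import Data.Bool using (Bool; true; false; _∧_; _∨_; not; if_then_else_)
open import Data.List using (List; []; _∷_; _++_; length; map; filterᵇ; foldr; deduplicate)
open import Data.List.Relation.Unary.All using (All)
open import Data.Maybe using (Maybe; just; nothing)
open import Data.Product using (_×_; _,_; proj₁; proj₂)

data PreOrd : List ℕ → Set where
  leaf : PreOrd []
  node : ∀ {x L R} → PreOrd L → PreOrd R →
         All (λ y → y < x) L → All (λ y → x < y) R →
         PreOrd (x ∷ L ++ R)

-- Geometric model: points (column , time).

Point : Set
Point = ℕ × ℕ

latest : ℕ → List Point → Maybe ℕ
latest b [] = nothing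
latest b ((c , s) ∷ P) with latest b P
... | just u  = just u
... | nothing = if c ≡ᵇ b then just s else nothing
-- (points are stored in increasing time order, so the last one in
--  column b is the latest)

columns : List Point → List ℕ
columns P = deduplicate _≟_ (map proj₁ P)

between : ℕ → ℕ → ℕ → Bool
between u v w = ((u ≤ᵇ w) ∧ (w ≤ᵇ v)) ∨ ((v ≤ᵇ w) ∧ (w ≤ᵇ u))

allᵇ : {A : Set} → (A → Bool) → List A → Bool
allᵇ p [] = true
allᵇ p (x ∷ xs) = p x ∧ allᵇ p xs

-- the closed rectangle with corners (a,t),(b,τ) contains no point of P
-- (P = the points at times < t) other than (b,τ)
emptyRect : ℕ → ℕ → ℕ → ℕ → List Point → Bool
emptyRect a t b τ P =
  allᵇ (λ p → ((proj₁ p ≡ᵇ b) ∧ (proj₂ p ≡ᵇ τ))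
              ∨ not (between a b (proj₁ p) ∧ between τ t (proj₂ p))) P

touch : ℕ → ℕ → List Point → ℕ → Bool
touch a t P b with latest b P
... | nothing = false
... | just τ  = not (b ≡ᵇ a) ∧ emptyRect a t b τ P

step : ℕ → ℕ → List Point → List Point
step t a P = P ++ ((a , t) ∷ map (λ b → (b , t)) (filterᵇ (touch a t P) (columns P)))

run : ℕ → List ℕ → List Point → List Point
run t [] P = P
run t (a ∷ X) P = run (suc t) X (step t a P)

-- Greedy(X): number of output points, no initial tree, times 1..n
Greedy : List ℕ → ℕ
Greedy X = length (run 1 X [])

module Submission where

-- Write τ P c for the latest time of an output point of P in column c (0 if
-- there is none).  A column is a *stair* if it is non-empty and every column
-- to its right has a strictly earlier latest time; the potential Φ counts
-- the stairs.  Greedy is followed along the recursive structure of the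
-- preorder sequence: the subtree with keys in the open interval (lo , hi) is
-- served from a state in which the columns strictly inside the interval are
-- still empty, the boundary columns are non-empty, and no column at or right
-- of hi is later than lo or hi (record Interval).  In such a state the access
-- to the subtree root x touches only lo, hi and stairs left of x, while the
-- stairs afterwards are old stairs right of x plus one new column (hi, or x
-- itself when there is no hi).  Hence  1 + #touched + Φ' ≤ 4 + Φ.

open import Defs
open import Data.Nat using (ℕ; _≤_; _*_)
open import Data.List using (List; length)

open import Data.Nat using (zero; suc; _+_; _<_; _<ᵇ_; _≤ᵇ_; _≡ᵇ_; z≤n; s≤s; s≤s⁻¹; z<s)
open import Data.Nat.Properties
open import Data.Bool using (Bool; true; false; _∧_; _∨_; not; T)
open import Data.Bool.Properties using (T-∧; T-∨; T-≡; T-not-≡)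
open import Data.Maybe using (Maybe; just; nothing; fromMaybe; _<∣>_)
open import Data.Product using (_×_; _,_; proj₁; proj₂; ∃)
open import Data.Sum using (_⊎_; inj₁; inj₂)
open import Data.Empty using (⊥-elim)
open import Data.Unit using (⊤; tt)
open import Function using (_∘_)
open import Function.Bundles using (Equivalence)
open import Relation.Nullary using (¬_; yes; no)
open import Relation.Nullary.Decidable using (T?)
open import Relation.Binary.Definitions using (tri<; tri≈; tri>)
open import Relation.Binary.PropositionalEquality
open import Data.List using ([]; _∷_; _++_; map; filterᵇ; downFrom)
open import Data.List.Properties using (length-++; length-map)
open import Data.List.Membership.Propositional using (_∈_; _∉_)
open import Data.List.Membership.Propositional.Properties
  using (∈-deduplicate⁺; ∈-deduplicate⁻; ∈-map⁺; ∈-map⁻; ∈-filter⁺; ∈-filter⁻; ∈-++⁻; ∈-downFrom⁺; ∈-downFrom⁻)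
open import Data.List.Relation.Unary.Any using (here; there)
open import Data.List.Relation.Unary.All using (All; []; _∷_)
import Data.List.Relation.Unary.All as All
import Data.List.Relation.Unary.All.Properties as All
open import Data.List.Relation.Unary.AllPairs using ([]; _∷_)
open import Data.List.Relation.Unary.Unique.Propositional using (Unique)
import Data.List.Relation.Unary.Unique.Propositional.Properties as Unique
open import Data.List.Relation.Unary.Unique.DecPropositional.Properties using (deduplicate-!)
open import Algebra.Properties.CommutativeSemigroup +-commutativeSemigroup using (interchange)
open import Data.Nat.Solver using (module +-*-Solver)

open Equivalence using (to; from)

𝟙 : Bool → ℕ
𝟙 true  = 1
𝟙 false = 0

T-not⁻ : ∀ {b} → T (not b) → ¬ T b
T-not⁻ {false} _ ()

T-not⁺ : ∀ {b} → ¬ T b → T (not b)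
T-not⁺ {false} _ = tt
T-not⁺ {true}  f = f tt

≡ᵇ-refl : ∀ n → (n ≡ᵇ n) ≡ true
≡ᵇ-refl n = to T-≡ (≡⇒≡ᵇ n n refl)

≡ᵇ-≢ : ∀ {m n} → m ≢ n → (m ≡ᵇ n) ≡ false
≡ᵇ-≢ {m} {n} m≢n = to T-not-≡ (T-not⁺ (m≢n ∘ ≡ᵇ⇒≡ m n))

allᵇ⁻ : ∀ {A : Set} (p : A → Bool) {xs x} → T (allᵇ p xs) → x ∈ xs → T (p x)
allᵇ⁻ p {y ∷ ys} h (here refl) = proj₁ (to T-∧ h)
allᵇ⁻ p {y ∷ ys} h (there x∈ys) = allᵇ⁻ p (proj₂ (to (T-∧ {p y}) h)) x∈ys

allᵇ⁺ : ∀ {A : Set} (p : A → Bool) xs → (∀ {x} → x ∈ xs → T (p x)) → T (allᵇ p xs)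
allᵇ⁺ p []       h = tt
allᵇ⁺ p (x ∷ xs) h = from T-∧ (h (here refl) , allᵇ⁺ p xs (h ∘ there))

between⁺ : ∀ {u v w} → u ≤ w → w ≤ v → T (between u v w)
between⁺ u≤w w≤v = from T-∨ (inj₁ (from T-∧ (≤⇒≤ᵇ u≤w , ≤⇒≤ᵇ w≤v)))

between⁺′ : ∀ {u v w} → v ≤ w → w ≤ u → T (between u v w)
between⁺′ {u} {v} {w} v≤w w≤u =
  from (T-∨ {(u ≤ᵇ w) ∧ (w ≤ᵇ v)}) (inj₂ (from T-∧ (≤⇒≤ᵇ v≤w , ≤⇒≤ᵇ w≤u)))

between⁻ : ∀ {u v w} → T (between u v w) → (u ≤ w × w ≤ v) ⊎ (v ≤ w × w ≤ u)
between⁻ {u} {v} {w} h with to (T-∨ {(u ≤ᵇ w) ∧ (w ≤ᵇ v)}) h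
... | inj₁ p = let (a , b) = to T-∧ p in inj₁ (≤ᵇ⇒≤ u w a , ≤ᵇ⇒≤ w v b)
... | inj₂ p = let (a , b) = to T-∧ p in inj₂ (≤ᵇ⇒≤ v w a , ≤ᵇ⇒≤ w u b)

τ : List Point → ℕ → ℕ
τ P c = fromMaybe 0 (latest c P)

latest-++ : ∀ c P Q → latest c (P ++ Q) ≡ (latest c Q <∣> latest c P)
latest-++ c [] Q with latest c Q
... | just u  = refl
... | nothing = refl
latest-++ c ((d , s) ∷ P) Q rewrite latest-++ c P Q with latest c Q
... | just u  = refl
... | nothing = refl

latest-∈ : ∀ c P {u} → latest c P ≡ just u → (c , u) ∈ P
latest-∈ c ((d , s) ∷ P) eq with latest c P in e
latest-∈ c ((d , s) ∷ P) refl | just v = there (latest-∈ c P e)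
latest-∈ c ((d , s) ∷ P) eq   | nothing with d ≡ᵇ c in d≡c
latest-∈ c ((d , s) ∷ P) refl | nothing | true
  rewrite ≡ᵇ⇒≡ d c (from T-≡ d≡c) = here refl

τ-∈ : ∀ P c → 0 < τ P c → (c , τ P c) ∈ P
τ-∈ P c 0<τ with latest c P in e
... | just u  = latest-∈ c P e
... | nothing = ⊥-elim (<-irrefl refl 0<τ)

row : ℕ → List ℕ → List Point
row t = map (λ b → (b , t))

latest-row : ∀ c t F → (c ∈ F × latest c (row t F) ≡ just t) ⊎ (c ∉ F × latest c (row t F) ≡ nothing)
latest-row c t [] = inj₂ ((λ ()) , refl)
latest-row c t (b ∷ F) with latest-row c t F
... | inj₁ (c∈F , e) rewrite e = inj₁ (there c∈F , refl)
... | inj₂ (c∉F , e) rewrite e with b ≟ c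
...   | yes refl rewrite ≡ᵇ-refl b = inj₁ (here refl , refl)
...   | no b≢c rewrite ≡ᵇ-≢ b≢c = inj₂ (c∉b∷F , refl)
  where
  c∉b∷F : c ∉ b ∷ F
  c∉b∷F (here refl) = b≢c refl
  c∉b∷F (there c∈F) = c∉F c∈F

column⁺ : ∀ {P c s} → (c , s) ∈ P → c ∈ columns P
column⁺ p∈P = ∈-deduplicate⁺ _≟_ (∈-map⁺ proj₁ p∈P)

column⁻ : ∀ {P c} → c ∈ columns P → ∃ λ s → (c , s) ∈ P
column⁻ {P} c∈ with ∈-map⁻ proj₁ (∈-deduplicate⁻ _≟_ (map proj₁ P) c∈)
... | (c , s) , p∈P , refl = s , p∈P

record WellFormed (N t : ℕ) (P : List Point) : Set where
  field
    t-pos    : 1 ≤ t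
    time-pos : ∀ {c s} → (c , s) ∈ P → 1 ≤ s
    time<t   : ∀ {c s} → (c , s) ∈ P → s < t
    time≤τ   : ∀ {c s} → (c , s) ∈ P → s ≤ τ P c
    column<N : ∀ {c s} → (c , s) ∈ P → c < N
open WellFormed

τ<t : ∀ {N t P} → WellFormed N t P → ∀ c → τ P c < t
τ<t {P = P} W c with τ P c in e
... | zero  = t-pos W
... | suc k = subst (_< _) e (time<t W (τ-∈ P c (subst (0 <_) (sym e) z<s)))

touch⇒ : ∀ {N t P a b} → WellFormed N t P → T (touch a t P b) →
         b ≢ a × 0 < τ P b × (∀ d → T (between a b d) → d ≢ b → τ P d < τ P b)
touch⇒ {N} {t} {P} {a} {b} W h with latest b P in e
... | just u = b≢a , 0<u , rect
  where
  b≢a : b ≢ a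
  b≢a refl = T-not⁻ (proj₁ (to T-∧ h)) (≡⇒≡ᵇ b b refl)
  0<u : 0 < u
  0<u = time-pos W (latest-∈ b P e)
  rect : ∀ d → T (between a b d) → d ≢ b → τ P d < u
  rect d a-d-b d≢b with τ P d in ed
  ... | zero  = 0<u
  ... | suc k with suc k <? u
  ...   | yes k<u = k<u
  ...   | no  k≮u = ⊥-elim (in-rectangle (allᵇ⁻ _ (proj₂ (to (T-∧ {not (b ≡ᵇ a)}) h)) dk∈P))
    where
    dk∈P : (d , suc k) ∈ P
    dk∈P = subst (λ s → (d , s) ∈ P) ed (τ-∈ P d (subst (0 <_) (sym ed) z<s))
    in-rectangle : ¬ T (((d ≡ᵇ b) ∧ (suc k ≡ᵇ u)) ∨ not (between a b d ∧ between u t (suc k)))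
    in-rectangle x with to (T-∨ {(d ≡ᵇ b) ∧ (suc k ≡ᵇ u)}) x
    ... | inj₁ y = d≢b (≡ᵇ⇒≡ d b (proj₁ (to T-∧ y)))
    ... | inj₂ y = T-not⁻ y (from T-∧ (a-d-b , between⁺ (≮⇒≥ k≮u) (<⇒≤ (time<t W dk∈P))))

touch⇐ : ∀ {N t P a b} → WellFormed N t P → b ≢ a → 0 < τ P b →
         (∀ d → T (between a b d) → d ≢ b → τ P d ≡ 0) → T (touch a t P b)
touch⇐ {N} {t} {P} {a} {b} W b≢a 0<τb empty with latest b P in e
... | nothing = ⊥-elim (<-irrefl refl 0<τb)
... | just u  = from T-∧ (T-not⁺ (b≢a ∘ ≡ᵇ⇒≡ b a) , allᵇ⁺ _ P outside)
  where
  outside : ∀ {p} → p ∈ P → T (((proj₁ p ≡ᵇ b) ∧ (proj₂ p ≡ᵇ u)) ∨ not (between a b (proj₁ p) ∧ between u t (proj₂ p)))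
  outside {c , s} p∈P with c ≟ b
  ... | no c≢b = from (T-∨ {(c ≡ᵇ b) ∧ (s ≡ᵇ u)}) (inj₂ (T-not⁺ λ x →
          <⇒≱ (≤-trans (time-pos W p∈P) (time≤τ W p∈P)) (≤-reflexive (empty c (proj₁ (to T-∧ x)) c≢b))))
  ... | yes refl with s ≟ u
  ...   | yes refl = from T-∨ (inj₁ (from T-∧ (≡⇒≡ᵇ c c refl , ≡⇒≡ᵇ s s refl)))
  ...   | no s≢u  = from (T-∨ {(c ≡ᵇ c) ∧ (s ≡ᵇ u)}) (inj₂ (T-not⁺ λ x →
            not-in-time (between⁻ (proj₂ (to (T-∧ {between a c c}) x)))))
    where
    s<u : s < u
    s<u = ≤∧≢⇒< (subst (s ≤_) (cong (fromMaybe 0) e) (time≤τ W p∈P)) s≢u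
    not-in-time : ¬ ((u ≤ s × s ≤ t) ⊎ (t ≤ s × s ≤ u))
    not-in-time (inj₁ (u≤s , _)) = <⇒≱ s<u u≤s
    not-in-time (inj₂ (t≤s , _)) = <⇒≱ (time<t W p∈P) t≤s

touched : ℕ → ℕ → List Point → List ℕ
touched t a P = filterᵇ (touch a t P) (columns P)

touched⁺ : ∀ {N t a P c} → WellFormed N t P → T (touch a t P c) → c ∈ touched t a P
touched⁺ {t = t} {a} {P} {c} W h =
  ∈-filter⁺ (T? ∘ touch a t P) (column⁺ (τ-∈ P c (proj₁ (proj₂ (touch⇒ W h))))) h

touched⁻ : ∀ {t a P c} → c ∈ touched t a P → T (touch a t P c)
touched⁻ {t} {a} {P} c∈ = proj₂ (∈-filter⁻ (T? ∘ touch a t P) {xs = columns P} c∈)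

τ-step-hit : ∀ t a P c → c ≡ a ⊎ c ∈ touched t a P → τ (step t a P) c ≡ t
τ-step-hit t a P c h rewrite latest-++ c P ((a , t) ∷ row t (touched t a P))
  with latest-row c t (touched t a P) | h
... | inj₁ (_ , e)   | _           rewrite e = refl
... | inj₂ (c∉ , e)  | inj₂ c∈     = ⊥-elim (c∉ c∈)
... | inj₂ (_ , e)   | inj₁ refl   rewrite e | ≡ᵇ-refl c = refl

τ-step-miss : ∀ t a P c → c ≢ a → c ∉ touched t a P → τ (step t a P) c ≡ τ P c
τ-step-miss t a P c c≢a c∉ rewrite latest-++ c P ((a , t) ∷ row t (touched t a P))
  with latest-row c t (touched t a P)
... | inj₁ (c∈ , _) = ⊥-elim (c∉ c∈)
... | inj₂ (_ , e)  rewrite e | ≡ᵇ-≢ (c≢a ∘ sym) = refl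

length-step : ∀ t a P → length (step t a P) ≡ length P + suc (length (touched t a P))
length-step t a P
  rewrite length-++ P {(a , t) ∷ row t (touched t a P)} | length-map (λ b → (b , t)) (touched t a P) = refl

Σ< : ℕ → (ℕ → ℕ) → ℕ
Σ< zero    f = 0
Σ< (suc n) f = f n + Σ< n f

Σ<-mono : ∀ n {f g} → (∀ c → f c ≤ g c) → Σ< n f ≤ Σ< n g
Σ<-mono zero    f≤g = z≤n
Σ<-mono (suc n) f≤g = +-mono-≤ (f≤g n) (Σ<-mono n f≤g)

Σ<-+ : ∀ n f g → Σ< n (λ c → f c + g c) ≡ Σ< n f + Σ< n g
Σ<-+ zero    f g = refl
Σ<-+ (suc n) f g rewrite Σ<-+ n f g = interchange (f n) (g n) (Σ< n f) (Σ< n g)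

Σ<-zero : ∀ n → Σ< n (λ _ → 0) ≡ 0
Σ<-zero zero    = refl
Σ<-zero (suc n) = Σ<-zero n

Σ<-single-≤y : ∀ n y → n ≤ y → Σ< n (λ c → 𝟙 (c ≡ᵇ y)) ≡ 0
Σ<-single-≤y zero    y _   = refl
Σ<-single-≤y (suc n) y n<y rewrite ≡ᵇ-≢ (λ n≡y → <-irrefl n≡y n<y) = Σ<-single-≤y n y (<⇒≤ n<y)

Σ<-single : ∀ n y → Σ< n (λ c → 𝟙 (c ≡ᵇ y)) ≤ 1
Σ<-single zero    y = z≤n
Σ<-single (suc n) y with n ≟ y
... | yes refl rewrite ≡ᵇ-refl n | Σ<-single-≤y n n ≤-refl = ≤-refl
... | no  n≢y  rewrite ≡ᵇ-≢ n≢y = Σ<-single n y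

Σ<-single->y : ∀ n y → y < n → 1 ≤ Σ< n (λ c → 𝟙 (c ≡ᵇ y))
Σ<-single->y (suc n) y y<1+n with n ≟ y
... | yes refl rewrite ≡ᵇ-refl n = s≤s z≤n
... | no  n≢y  rewrite ≡ᵇ-≢ n≢y = Σ<-single->y n y (≤∧≢⇒< (s≤s⁻¹ y<1+n) (n≢y ∘ sym))

occurrences : List ℕ → ℕ → ℕ
occurrences []       c = 0
occurrences (y ∷ ys) c = 𝟙 (c ≡ᵇ y) + occurrences ys c

length-occurrences : ∀ n ys → All (_< n) ys → length ys ≤ Σ< n (occurrences ys)
length-occurrences n []       []           = z≤n
length-occurrences n (y ∷ ys) (y<n ∷ ys<n) rewrite Σ<-+ n (λ c → 𝟙 (c ≡ᵇ y)) (occurrences ys) =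
  +-mono-≤ (Σ<-single->y n y y<n) (length-occurrences n ys ys<n)

occurrences-∉ : ∀ c ys → All (c ≢_) ys → occurrences ys c ≡ 0
occurrences-∉ c []       []             = refl
occurrences-∉ c (y ∷ ys) (c≢y ∷ c∉ys) rewrite ≡ᵇ-≢ c≢y = occurrences-∉ c ys c∉ys

occurrences-unique : ∀ (p : ℕ → Bool) ys → Unique ys → All (T ∘ p) ys → ∀ c → occurrences ys c ≤ 𝟙 (p c)
occurrences-unique p []       []             []          c = z≤n
occurrences-unique p (y ∷ ys) (y∉ys ∷ uniq) (py ∷ pys) c with c ≟ y
... | yes refl rewrite ≡ᵇ-refl c | occurrences-∉ c ys y∉ys | to T-≡ py = ≤-refl
... | no  c≢y  rewrite ≡ᵇ-≢ c≢y = occurrences-unique p ys uniq pys c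

length-unique : ∀ (p : ℕ → Bool) n ys → Unique ys → All (_< n) ys → All (T ∘ p) ys →
                length ys ≤ Σ< n (𝟙 ∘ p)
length-unique p n ys uniq ys<n pys =
  ≤-trans (length-occurrences n ys ys<n) (Σ<-mono n (occurrences-unique p ys uniq pys))

length-touched : ∀ {N t a P} → WellFormed N t P → length (touched t a P) ≤ Σ< N (𝟙 ∘ touch a t P)
length-touched {N} {t} {a} {P} W =
  length-unique (touch a t P) N (touched t a P)
    (Unique.filter⁺ (T? ∘ touch a t P) (deduplicate-! _≟_ (map proj₁ P)))
    (All.filter⁺ (T? ∘ touch a t P) (All.tabulate λ c∈ → column<N W (proj₂ (column⁻ c∈))))
    (All.all-filter (T? ∘ touch a t P) (columns P))

Stair : ℕ → List Point → ℕ → Set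
Stair N P c = 0 < τ P c × (∀ d → c < d → d < N → τ P d < τ P c)

stairᵇ : ℕ → List Point → ℕ → Bool
stairᵇ N P c = (0 <ᵇ τ P c) ∧ allᵇ (λ d → not (c <ᵇ d) ∨ (τ P d <ᵇ τ P c)) (downFrom N)

stair⁺ : ∀ N P c → Stair N P c → T (stairᵇ N P c)
stair⁺ N P c (0<τc , later) = from T-∧ (<⇒<ᵇ 0<τc , allᵇ⁺ _ (downFrom N) right-earlier)
  where
  right-earlier : ∀ {d} → d ∈ downFrom N → T (not (c <ᵇ d) ∨ (τ P d <ᵇ τ P c))
  right-earlier {d} d∈ with c <? d
  ... | yes c<d = from (T-∨ {not (c <ᵇ d)}) (inj₂ (<⇒<ᵇ (later d c<d (∈-downFrom⁻ d∈))))
  ... | no  c≮d = from T-∨ (inj₁ (T-not⁺ (c≮d ∘ <ᵇ⇒< c d)))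

stair⁻ : ∀ N P c → T (stairᵇ N P c) → Stair N P c
stair⁻ N P c h = <ᵇ⇒< 0 (τ P c) (proj₁ (to T-∧ h)) , later
  where
  later : ∀ d → c < d → d < N → τ P d < τ P c
  later d c<d d<N with to (T-∨ {not (c <ᵇ d)}) (allᵇ⁻ _ (proj₂ (to (T-∧ {0 <ᵇ τ P c}) h)) (∈-downFrom⁺ d<N))
  ... | inj₁ c≮d = ⊥-elim (T-not⁻ c≮d (<⇒<ᵇ c<d))
  ... | inj₂ d<c = <ᵇ⇒< (τ P d) (τ P c) d<c

Φ : ℕ → List Point → ℕ
Φ N P = Σ< N (𝟙 ∘ stairᵇ N P)

Φ-empty : ∀ N → Φ N [] ≡ 0
Φ-empty N = Σ<-zero N

𝟙-≤ : ∀ a l s → (T a → T l ⊎ T s) → 𝟙 a ≤ 𝟙 l + 𝟙 s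
𝟙-≤ false l     s     _ = z≤n
𝟙-≤ true  true  s     _ = s≤s z≤n
𝟙-≤ true  false true  _ = ≤-refl
𝟙-≤ true  false false h with h tt
... | inj₁ ()
... | inj₂ ()

𝟙-∨ : ∀ a b → 𝟙 (a ∨ b) ≤ 𝟙 a + 𝟙 b
𝟙-∨ a b = 𝟙-≤ (a ∨ b) a b (to T-∨)

𝟙-∧-exclusive : ∀ s p q → ¬ (T p × T q) → 𝟙 (s ∧ p) + 𝟙 (s ∧ q) ≤ 𝟙 s
𝟙-∧-exclusive false p     q     _ = z≤n
𝟙-∧-exclusive true  true  true  h = ⊥-elim (h (tt , tt))
𝟙-∧-exclusive true  true  false _ = ≤-refl
𝟙-∧-exclusive true  false true  _ = ≤-refl
𝟙-∧-exclusive true  false false _ = z≤n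

-- Accounting of one access at column x: a touched column is a boundary
-- (l₁ or l₂) or a stair s left of x; a stair afterwards is the new column r
-- or an old stair right of x.
amortise : ∀ {c x} a b l₁ l₂ r s →
           (T a → T (l₁ ∨ l₂) ⊎ T (s ∧ (c <ᵇ x))) → (T b → T r ⊎ T (s ∧ (x <ᵇ c))) →
           𝟙 a + 𝟙 b ≤ (𝟙 l₁ + 𝟙 l₂ + 𝟙 r) + 𝟙 s
amortise {c} {x} a b l₁ l₂ r s ha hb = begin
  𝟙 a + 𝟙 b
    ≤⟨ +-mono-≤ (𝟙-≤ a _ _ ha) (𝟙-≤ b _ _ hb) ⟩
  (𝟙 (l₁ ∨ l₂) + 𝟙 (s ∧ (c <ᵇ x))) + (𝟙 r + 𝟙 (s ∧ (x <ᵇ c)))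
    ≡⟨ interchange (𝟙 (l₁ ∨ l₂)) _ (𝟙 r) _ ⟩
  (𝟙 (l₁ ∨ l₂) + 𝟙 r) + (𝟙 (s ∧ (c <ᵇ x)) + 𝟙 (s ∧ (x <ᵇ c)))
    ≤⟨ +-mono-≤ (+-monoˡ-≤ (𝟙 r) (𝟙-∨ l₁ l₂)) (𝟙-∧-exclusive s (c <ᵇ x) (x <ᵇ c) exclusive) ⟩
  (𝟙 l₁ + 𝟙 l₂ + 𝟙 r) + 𝟙 s ∎
  where
  open ≤-Reasoning
  exclusive : ¬ (T (c <ᵇ x) × T (x <ᵇ c))
  exclusive (c<x , x<c) = <-asym (<ᵇ⇒< c x c<x) (<ᵇ⇒< x c x<c)

-- Open intervals (lo , hi) of keys; a missing bound stands for ∓∞.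
Above : Maybe ℕ → ℕ → Set
Above nothing  c = ⊤
Above (just l) c = l < c

Below : Maybe ℕ → ℕ → Set
Below nothing  c = ⊤
Below (just h) c = c < h

Above-mono : ∀ lo {c d} → Above lo c → c ≤ d → Above lo d
Above-mono nothing  _   _   = tt
Above-mono (just l) l<c c≤d = <-≤-trans l<c c≤d

Below-mono : ∀ hi {c d} → Below hi c → d ≤ c → Below hi d
Below-mono nothing  _   _   = tt
Below-mono (just h) c<h d≤c = ≤-<-trans d≤c c<h

below-or-beyond : ∀ hi d → Below hi d ⊎ ∃ λ h → hi ≡ just h × h ≤ d
below-or-beyond nothing  d = inj₁ tt
below-or-beyond (just h) d with d <? h
... | yes d<h = inj₁ d<h
... | no  d≮h = inj₂ (h , refl , ≮⇒≥ d≮h)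

isBound : Maybe ℕ → ℕ → Bool
isBound nothing  c = false
isBound (just l) c = c ≡ᵇ l

isBound-self : ∀ {m c} → m ≡ just c → T (isBound m c)
isBound-self {c = c} refl = ≡⇒≡ᵇ c c refl

Σ<-isBound : ∀ n m → Σ< n (𝟙 ∘ isBound m) ≤ 1
Σ<-isBound n nothing  rewrite Σ<-zero n = z≤n
Σ<-isBound n (just l) = Σ<-single n l

-- The column that becomes a stair when x is accessed inside (lo , hi):
-- the upper boundary, or x itself if the interval is unbounded above.
newStair : Maybe ℕ → ℕ → ℕ
newStair nothing  x = x
newStair (just h) x = h

record Interval (N t : ℕ) (P : List Point) (lo hi : Maybe ℕ) : Set where
  field
    wf           : WellFormed N t P
    inside-empty : ∀ c → Above lo c → Below hi c → τ P c ≡ 0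
    lo-nonempty  : ∀ {l} → lo ≡ just l → 0 < τ P l
    hi-nonempty  : ∀ {h} → hi ≡ just h → 0 < τ P h
    beyond≤hi    : ∀ {h} → hi ≡ just h → ∀ e → h ≤ e → τ P e ≤ τ P h
    beyond≤lo    : ∀ {h l} → hi ≡ just h → lo ≡ just l → ∀ e → h ≤ e → τ P e ≤ τ P l

module Access {N t : ℕ} {P : List Point} {lo hi : Maybe ℕ} (I : Interval N t P lo hi)
              (x : ℕ) (lo<x : Above lo x) (x<hi : Below hi x) (x<N : x < N) where
  open Interval I

  P′ : List Point
  P′ = step t x P

  tch : ℕ → Bool
  tch = touch x t P

  τx≡0 : τ P x ≡ 0
  τx≡0 = inside-empty x lo<x x<hi

  τ-hit : ∀ c → c ≡ x ⊎ T (tch c) → τ P′ c ≡ t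
  τ-hit c (inj₁ c≡x) = τ-step-hit t x P c (inj₁ c≡x)
  τ-hit c (inj₂ tc)  = τ-step-hit t x P c (inj₂ (touched⁺ wf tc))

  data Effect (c : ℕ) : Set where
    hit  : c ≡ x ⊎ T (tch c) → τ P′ c ≡ t → Effect c
    miss : c ≢ x → ¬ T (tch c) → τ P′ c ≡ τ P c → Effect c

  effect : ∀ c → Effect c
  effect c with c ≟ x | T? (tch c)
  ... | yes c≡x | _       = hit (inj₁ c≡x) (τ-hit c (inj₁ c≡x))
  ... | no  c≢x | yes tc  = hit (inj₂ tc) (τ-hit c (inj₂ tc))
  ... | no  c≢x | no  ¬tc = miss c≢x ¬tc (τ-step-miss t x P c c≢x (¬tc ∘ touched⁻ {t} {x} {P}))

  τ-mono : ∀ c → τ P c ≤ τ P′ c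
  τ-mono c with effect c
  ... | hit  _ e   rewrite e = <⇒≤ (τ<t wf c)
  ... | miss _ _ e rewrite e = ≤-refl

  new-point : ∀ {c s} → (c , s) ∈ (x , t) ∷ row t (touched t x P) → s ≡ t × (c ≡ x ⊎ T (tch c))
  new-point (here refl) = refl , inj₁ refl
  new-point (there p∈)  with ∈-map⁻ (λ b → (b , t)) p∈
  ... | b , b∈ , refl = refl , inj₂ (touched⁻ {t} {x} {P} b∈)

  wf′ : WellFormed N (suc t) P′
  wf′ = record { t-pos = s≤s z≤n ; time-pos = pos ; time<t = before ; time≤τ = latest′ ; column<N = inside }
    where
    pos : ∀ {c s} → (c , s) ∈ P′ → 1 ≤ s
    pos p∈ with ∈-++⁻ P p∈
    ... | inj₁ old = time-pos wf old
    ... | inj₂ new with new-point new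
    ...   | refl , _ = t-pos wf
    before : ∀ {c s} → (c , s) ∈ P′ → s < suc t
    before p∈ with ∈-++⁻ P p∈
    ... | inj₁ old = m≤n⇒m≤1+n (time<t wf old)
    ... | inj₂ new with new-point new
    ...   | refl , _ = ≤-refl
    latest′ : ∀ {c s} → (c , s) ∈ P′ → s ≤ τ P′ c
    latest′ {c} p∈ with ∈-++⁻ P p∈
    ... | inj₁ old = ≤-trans (time≤τ wf old) (τ-mono c)
    ... | inj₂ new with new-point new
    ...   | refl , h = ≤-reflexive (sym (τ-hit c h))
    inside : ∀ {c s} → (c , s) ∈ P′ → c < N
    inside {c} p∈ with ∈-++⁻ P p∈
    ... | inj₁ old = column<N wf old
    ... | inj₂ new with new-point new
    ...   | refl , inj₁ refl = x<N
    ...   | refl , inj₂ tc   = column<N wf (τ-∈ P c (proj₁ (proj₂ (touch⇒ wf tc))))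

  τ′≤t : ∀ c → τ P′ c ≤ t
  τ′≤t c = s≤s⁻¹ (τ<t wf′ c)

  τ′x≡t : τ P′ x ≡ t
  τ′x≡t = τ-hit x (inj₁ refl)

  -- The boundary columns are touched: everything between them and x is empty.
  τ′lo≡t : ∀ {l} → lo ≡ just l → τ P′ l ≡ t
  τ′lo≡t {l} refl = τ-hit l (inj₂ (touch⇐ wf (λ l≡x → <-irrefl l≡x lo<x) (lo-nonempty refl) empty))
    where
    empty : ∀ d → T (between x l d) → d ≢ l → τ P d ≡ 0
    empty d x-d-l d≢l with between⁻ x-d-l
    ... | inj₁ (x≤d , d≤l) = ⊥-elim (<-irrefl refl (<-≤-trans lo<x (≤-trans x≤d d≤l)))
    ... | inj₂ (l≤d , d≤x) with d ≟ x
    ...   | yes refl = τx≡0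
    ...   | no  d≢x  = inside-empty d (≤∧≢⇒< l≤d (d≢l ∘ sym)) (Below-mono hi x<hi d≤x)

  τ′hi≡t : ∀ {h} → hi ≡ just h → τ P′ h ≡ t
  τ′hi≡t {h} refl = τ-hit h (inj₂ (touch⇐ wf (λ h≡x → <-irrefl (sym h≡x) x<hi) (hi-nonempty refl) empty))
    where
    empty : ∀ d → T (between x h d) → d ≢ h → τ P d ≡ 0
    empty d x-d-h d≢h with between⁻ x-d-h
    ... | inj₂ (h≤d , d≤x) = ⊥-elim (<-irrefl refl (<-≤-trans x<hi (≤-trans h≤d d≤x)))
    ... | inj₁ (x≤d , d≤h) with d ≟ x
    ...   | yes refl = τx≡0
    ...   | no  d≢x  = inside-empty d (Above-mono lo lo<x x≤d) (≤∧≢⇒< d≤h d≢h)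

  nonempty-after : ∀ c → 0 < τ P′ c → 0 < τ P c ⊎ c ≡ x
  nonempty-after c 0<τ′ with effect c
  ... | hit (inj₁ c≡x) _ = inj₂ c≡x
  ... | hit (inj₂ tc)  _ = inj₁ (proj₁ (proj₂ (touch⇒ wf tc)))
  ... | miss _ _ e       = inj₁ (subst (0 <_) e 0<τ′)

  -- Columns beyond hi are not touched: hi is later than all of them.
  beyond-unchanged : ∀ {h} → hi ≡ just h → ∀ c → h < c → τ P′ c ≡ τ P c
  beyond-unchanged {h} refl c h<c with effect c
  ... | miss _ _ e          = e
  ... | hit (inj₁ refl) _   = ⊥-elim (<-asym h<c x<hi)
  ... | hit (inj₂ tc) _     =
    ⊥-elim (<⇒≱ (proj₂ (proj₂ (touch⇒ wf tc)) h (between⁺ (<⇒≤ x<hi) (<⇒≤ h<c)) (λ h≡c → <-irrefl h≡c h<c))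
                (beyond≤hi refl c (<⇒≤ h<c)))

  touched-left : ∀ c → T (tch c) → c < x → lo ≡ just c ⊎ Stair N P c
  touched-left c tc c<x = by-lower-bound lo refl
    where
    0<τc : 0 < τ P c
    0<τc = proj₁ (proj₂ (touch⇒ wf tc))
    later : ∀ d → T (between x c d) → d ≢ c → τ P d < τ P c
    later = proj₂ (proj₂ (touch⇒ wf tc))
    c-outside : ¬ Above lo c
    c-outside lo<c = <-irrefl (sym (inside-empty c lo<c (Below-mono hi x<hi (<⇒≤ c<x)))) 0<τc
    by-lower-bound : ∀ m → lo ≡ m → lo ≡ just c ⊎ Stair N P c
    by-lower-bound nothing  lo≡ = ⊥-elim (c-outside (subst (λ m → Above m c) (sym lo≡) tt))
    by-lower-bound (just l) lo≡ with <-cmp c l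
    ... | tri≈ _ c≡l _ = inj₁ (trans lo≡ (cong just (sym c≡l)))
    ... | tri> _ _ l<c = ⊥-elim (c-outside (subst (λ m → Above m c) (sym lo≡) l<c))
    ... | tri< c<l _ _ = inj₂ (0<τc , right-earlier)
      where
      l<x : l < x
      l<x = subst (λ m → Above m x) lo≡ lo<x
      τl<τc : τ P l < τ P c
      τl<τc = later l (between⁺′ (<⇒≤ c<l) (<⇒≤ l<x)) (λ l≡c → <-irrefl (sym l≡c) c<l)
      right-earlier : ∀ d → c < d → d < N → τ P d < τ P c
      right-earlier d c<d d<N with d ≤? x
      ... | yes d≤x = later d (between⁺′ (<⇒≤ c<d) d≤x) (λ d≡c → <-irrefl (sym d≡c) c<d)
      ... | no  d≰x with below-or-beyond hi d
      ...   | inj₁ d<hi rewrite inside-empty d (Above-mono lo lo<x (<⇒≤ (≰⇒> d≰x))) d<hi = 0<τc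
      ...   | inj₂ (h , hi≡h , h≤d) = ≤-<-trans (beyond≤lo hi≡h lo≡ d h≤d) τl<τc

  touched-right : ∀ c → T (tch c) → x < c → hi ≡ just c
  touched-right c tc x<c with touch⇒ wf tc | below-or-beyond hi c
  ... | _ , 0<τc , _ | inj₁ c<hi =
    ⊥-elim (<-irrefl (sym (inside-empty c (Above-mono lo lo<x (<⇒≤ x<c)) c<hi)) 0<τc)
  ... | _ , _ , later | inj₂ (h , refl , h≤c) with c ≟ h
  ...   | yes refl = refl
  ...   | no  c≢h  = ⊥-elim (<⇒≱ (later h (between⁺ (<⇒≤ x<hi) h≤c) (c≢h ∘ sym)) (beyond≤hi refl c h≤c))

  touched-class : ∀ c → T (tch c) → T (isBound lo c ∨ isBound hi c) ⊎ T (stairᵇ N P c ∧ (c <ᵇ x))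
  touched-class c tc with <-cmp c x
  ... | tri≈ _ c≡x _ = ⊥-elim (proj₁ (touch⇒ wf tc) c≡x)
  ... | tri> _ _ x<c = inj₁ (from (T-∨ {isBound lo c}) (inj₂ (isBound-self (touched-right c tc x<c))))
  ... | tri< c<x _ _ with touched-left c tc c<x
  ...   | inj₁ lo≡c = inj₁ (from T-∨ (inj₁ (isBound-self lo≡c)))
  ...   | inj₂ st   = inj₂ (from T-∧ (stair⁺ N P c st , <⇒<ᵇ c<x))

  stair-after : ∀ c → T (stairᵇ N P′ c) → T (c ≡ᵇ newStair hi x) ⊎ T (stairᵇ N P c ∧ (x <ᵇ c))
  stair-after c st′ with stair⁻ N P′ c st′ | <-cmp c x
  ... | 0<τ′c , later | tri< c<x _ _ =
    ⊥-elim (<⇒≱ (subst (_< τ P′ c) τ′x≡t (later x c<x x<N)) (τ′≤t c))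
  ... | 0<τ′c , later | tri≈ _ refl _ = inj₁ (x-new hi refl)
    where
    x-new : ∀ m → hi ≡ m → T (c ≡ᵇ newStair m c)
    x-new nothing  _     = ≡⇒≡ᵇ c c refl
    x-new (just h) hi≡h  = ⊥-elim (<-irrefl (trans (τ′hi≡t hi≡h) (sym τ′x≡t))
                             (later h (subst (λ m → Below m c) hi≡h x<hi)
                                      (column<N wf (τ-∈ P h (hi-nonempty hi≡h)))))
  ... | 0<τ′c , later | tri> _ _ x<c with effect c
  ...   | hit (inj₁ c≡x) _ = ⊥-elim (<-irrefl (sym c≡x) x<c)
  ...   | hit (inj₂ tc) _ rewrite touched-right c tc x<c = inj₁ (≡⇒≡ᵇ c c refl)
  ...   | miss _ _ e = inj₂ (from T-∧ (stair⁺ N P c (subst (0 <_) e 0<τ′c , earlier) , <⇒<ᵇ x<c))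
    where
    earlier : ∀ d → c < d → d < N → τ P d < τ P c
    earlier d c<d d<N = ≤-<-trans (τ-mono d) (subst (τ P′ d <_) e (later d c<d d<N))

  special : ℕ → ℕ
  special c = 𝟙 (isBound lo c) + 𝟙 (isBound hi c) + 𝟙 (c ≡ᵇ newStair hi x)

  Σ<-special : Σ< N special ≤ 3
  Σ<-special = begin
    Σ< N special
      ≡⟨ Σ<-+ N (λ c → 𝟙 (isBound lo c) + 𝟙 (isBound hi c)) (λ c → 𝟙 (c ≡ᵇ newStair hi x)) ⟩
    Σ< N (λ c → 𝟙 (isBound lo c) + 𝟙 (isBound hi c)) + Σ< N (λ c → 𝟙 (c ≡ᵇ newStair hi x))
      ≡⟨ cong (_+ _) (Σ<-+ N (𝟙 ∘ isBound lo) (𝟙 ∘ isBound hi)) ⟩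
    Σ< N (𝟙 ∘ isBound lo) + Σ< N (𝟙 ∘ isBound hi) + Σ< N (λ c → 𝟙 (c ≡ᵇ newStair hi x))
      ≤⟨ +-mono-≤ (+-mono-≤ (Σ<-isBound N lo) (Σ<-isBound N hi)) (Σ<-single N (newStair hi x)) ⟩
    3 ∎
    where open ≤-Reasoning

  -- Touched columns and stairs after the access are paid for, column by
  -- column, by the special columns and the stairs before the access.
  touched+stairs : Σ< N (𝟙 ∘ tch) + Φ N P′ ≤ 3 + Φ N P
  touched+stairs = begin
    Σ< N (𝟙 ∘ tch) + Φ N P′
      ≡⟨ sym (Σ<-+ N (𝟙 ∘ tch) (𝟙 ∘ stairᵇ N P′)) ⟩
    Σ< N (λ c → 𝟙 (tch c) + 𝟙 (stairᵇ N P′ c))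
      ≤⟨ Σ<-mono N (λ c → amortise {c} {x} (tch c) (stairᵇ N P′ c) (isBound lo c) (isBound hi c)
                                   (c ≡ᵇ newStair hi x) (stairᵇ N P c) (touched-class c) (stair-after c)) ⟩
    Σ< N (λ c → special c + 𝟙 (stairᵇ N P c))
      ≡⟨ Σ<-+ N special (𝟙 ∘ stairᵇ N P) ⟩
    Σ< N special + Φ N P
      ≤⟨ +-monoˡ-≤ (Φ N P) Σ<-special ⟩
    3 + Φ N P ∎
    where open ≤-Reasoning

  amortised-cost : length P′ + Φ N P′ ≤ length P + Φ N P + 4
  amortised-cost = begin
    length P′ + Φ N P′
      ≡⟨ cong (_+ Φ N P′) (length-step t x P) ⟩
    length P + suc (length (touched t x P)) + Φ N P′
      ≤⟨ +-monoˡ-≤ (Φ N P′) (+-monoʳ-≤ (length P) (s≤s (length-touched wf))) ⟩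
    length P + suc (Σ< N (𝟙 ∘ tch)) + Φ N P′
      ≡⟨ +-assoc (length P) _ (Φ N P′) ⟩
    length P + suc (Σ< N (𝟙 ∘ tch) + Φ N P′)
      ≤⟨ +-monoʳ-≤ (length P) (s≤s touched+stairs) ⟩
    length P + (4 + Φ N P)
      ≡⟨ cong (length P +_) (+-comm 4 (Φ N P)) ⟩
    length P + (Φ N P + 4)
      ≡⟨ sym (+-assoc (length P) (Φ N P) 4) ⟩
    length P + Φ N P + 4 ∎
    where open ≤-Reasoning

record Served (N t : ℕ) (P : List Point) (lo hi : Maybe ℕ) (n : ℕ) (Q : List Point) : Set where
  field
    wf-after       : WellFormed N (t + n) Q
    nonempty-after : ∀ c → 0 < τ Q c → 0 < τ P c ⊎ (Above lo c × Below hi c)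
    beyond-fixed   : ∀ {h} → hi ≡ just h → ∀ c → h < c → τ Q c ≡ τ P c
    τ-grows        : ∀ c → τ P c ≤ τ Q c
    amortised      : length Q + Φ N Q ≤ length P + Φ N P + 4 * n

served-nothing : ∀ {N t P lo hi} → Interval N t P lo hi → Served N t P lo hi 0 P
served-nothing {N} {t} {P} I = record
  { wf-after       = subst (λ u → WellFormed N u P) (sym (+-identityʳ t)) (Interval.wf I)
  ; nonempty-after = λ _ 0<τ → inj₁ 0<τ
  ; beyond-fixed   = λ _ _ _ → refl
  ; τ-grows        = λ _ → ≤-refl
  ; amortised      = ≤-reflexive (sym (+-identityʳ _)) }

-- After accessing the root x of a subtree on (lo , hi), its left subtree is
-- served inside (lo , x) and then its right subtree inside (x , hi).
module Root {N t : ℕ} {P : List Point} {lo hi : Maybe ℕ} (I : Interval N t P lo hi)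
            (x : ℕ) (lo<x : Above lo x) (x<hi : Below hi x) (x<N : x < N) where
  open Interval I
  open Access I x lo<x x<hi x<N

  -- Times start at 1, so columns hit at time t become non-empty.
  0<t : 0 < t
  0<t = t-pos wf

  -- Right after the access, the left subtree's interval (lo , x) is set up:
  -- lo and x were just hit, hence nothing is later than them.
  leftInterval : Interval N (suc t) P′ lo (just x)
  leftInterval = record
    { wf           = wf′
    ; inside-empty = λ c lo<c c<x → n≤0⇒n≡0 (≮⇒≥ (still-empty c lo<c c<x))
    ; lo-nonempty  = λ lo≡l → subst (0 <_) (sym (τ′lo≡t lo≡l)) 0<t
    ; hi-nonempty  = λ { refl → subst (0 <_) (sym τ′x≡t) 0<t }
    ; beyond≤hi    = λ { refl e _ → subst (τ P′ e ≤_) (sym τ′x≡t) (τ′≤t e) }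
    ; beyond≤lo    = λ { refl lo≡l e _ → subst (τ P′ e ≤_) (sym (τ′lo≡t lo≡l)) (τ′≤t e) } }
    where
    still-empty : ∀ c → Above lo c → c < x → ¬ 0 < τ P′ c
    still-empty c lo<c c<x 0<τ′ with nonempty-after c 0<τ′
    ... | inj₁ 0<τ = <-irrefl (sym (inside-empty c lo<c (Below-mono hi x<hi (<⇒≤ c<x)))) 0<τ
    ... | inj₂ c≡x = <-irrefl c≡x c<x

  -- After serving the left subtree, the right subtree's interval (x , hi) is
  -- set up: the left subtree only filled columns below x, and x, hi stay
  -- at least as late as everything beyond hi, which was last changed at t.
  rightInterval : ∀ {n Q} → Served N (suc t) P′ lo (just x) n Q → Interval N (suc t + n) Q (just x) hi
  rightInterval {n} {Q} L = record
    { wf           = L.wf-after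
    ; inside-empty = λ c x<c c<hi → n≤0⇒n≡0 (≮⇒≥ (still-empty c x<c c<hi))
    ; lo-nonempty  = λ { refl → <-≤-trans (subst (0 <_) (sym τ′x≡t) 0<t) (L.τ-grows x) }
    ; hi-nonempty  = λ hi≡h → <-≤-trans (subst (0 <_) (sym (τ′hi≡t hi≡h)) 0<t) (L.τ-grows _)
    ; beyond≤hi    = beyond≤hi′
    ; beyond≤lo    = λ { hi≡h refl e h≤e → beyond≤x hi≡h e h≤e } }
    where
    module L = Served L
    still-empty : ∀ c → x < c → Below hi c → ¬ 0 < τ Q c
    still-empty c x<c c<hi 0<τQ with L.nonempty-after c 0<τQ
    ... | inj₂ (_ , c<x) = <-asym x<c c<x
    ... | inj₁ 0<τ′ with nonempty-after c 0<τ′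
    ...   | inj₁ 0<τ = <-irrefl (sym (inside-empty c (Above-mono lo lo<x (<⇒≤ x<c)) c<hi)) 0<τ
    ...   | inj₂ c≡x = <-irrefl (sym c≡x) x<c
    τQ-beyond : ∀ {h} → hi ≡ just h → ∀ e → h ≤ e → τ Q e ≡ τ P′ e
    τQ-beyond refl e h≤e = L.beyond-fixed refl e (<-≤-trans x<hi h≤e)
    beyond≤hi′ : ∀ {h} → hi ≡ just h → ∀ e → h ≤ e → τ Q e ≤ τ Q h
    beyond≤hi′ {h} hi≡h e h≤e rewrite τQ-beyond hi≡h e h≤e | τQ-beyond hi≡h h ≤-refl | τ′hi≡t hi≡h = τ′≤t e
    beyond≤x : ∀ {h} → hi ≡ just h → ∀ e → h ≤ e → τ Q e ≤ τ Q x
    beyond≤x hi≡h e h≤e rewrite τQ-beyond hi≡h e h≤e =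
      ≤-trans (subst (τ P′ e ≤_) (sym τ′x≡t) (τ′≤t e)) (L.τ-grows x)

  combine : ∀ {nL nR Q R} → (L : Served N (suc t) P′ lo (just x) nL Q) →
            Served N (suc t + nL) Q (just x) hi nR R → Served N t P lo hi (suc (nL + nR)) R
  combine {nL} {nR} {Q} {R} L S = record
    { wf-after       = subst (λ u → WellFormed N u R) elapsed S.wf-after
    ; nonempty-after = inside
    ; beyond-fixed   = λ { refl c h<c →
        trans (S.beyond-fixed refl c h<c)
              (trans (L.beyond-fixed refl c (<-trans x<hi h<c)) (beyond-unchanged refl c h<c)) }
    ; τ-grows        = λ c → ≤-trans (τ-mono c) (≤-trans (L.τ-grows c) (S.τ-grows c))
    ; amortised      = cost }
    where
    module L = Served L
    module S = Served S
    elapsed : suc t + nL + nR ≡ t + suc (nL + nR)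
    elapsed = trans (+-assoc (suc t) nL nR) (sym (+-suc t (nL + nR)))
    inside : ∀ c → 0 < τ R c → 0 < τ P c ⊎ (Above lo c × Below hi c)
    inside c 0<τR with S.nonempty-after c 0<τR
    ... | inj₂ (x<c , c<hi) = inj₂ (Above-mono lo lo<x (<⇒≤ x<c) , c<hi)
    ... | inj₁ 0<τQ with L.nonempty-after c 0<τQ
    ...   | inj₂ (lo<c , c<x) = inj₂ (lo<c , Below-mono hi x<hi (<⇒≤ c<x))
    ...   | inj₁ 0<τ′ with nonempty-after c 0<τ′
    ...     | inj₁ 0<τ  = inj₁ 0<τ
    ...     | inj₂ refl = inj₂ (lo<x , x<hi)
    cost : length R + Φ N R ≤ length P + Φ N P + 4 * suc (nL + nR)
    cost = begin
      length R + Φ N R                                   ≤⟨ S.amortised ⟩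
      length Q + Φ N Q + 4 * nR                          ≤⟨ +-monoˡ-≤ (4 * nR) L.amortised ⟩
      length P′ + Φ N P′ + 4 * nL + 4 * nR               ≤⟨ +-monoˡ-≤ (4 * nR) (+-monoˡ-≤ (4 * nL) amortised-cost) ⟩
      length P + Φ N P + 4 + 4 * nL + 4 * nR             ≡⟨ regroup (length P + Φ N P) nL nR ⟩
      length P + Φ N P + 4 * suc (nL + nR)               ∎
      where
      open ≤-Reasoning
      regroup : ∀ a l r → a + 4 + 4 * l + 4 * r ≡ a + 4 * suc (l + r)
      regroup = solve 3 (λ a l r → a :+ con 4 :+ con 4 :* l :+ con 4 :* r
                                   := a :+ con 4 :* (con 1 :+ (l :+ r))) refl
        where open +-*-Solver

run-++ : ∀ t L R P → run t (L ++ R) P ≡ run (t + length L) R (run t L P)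
run-++ t []      R P rewrite +-identityʳ t = refl
run-++ t (a ∷ L) R P rewrite +-suc t (length L) = run-++ (suc t) L R (step t a P)

serve : ∀ {Y} → PreOrd Y → ∀ {N t P lo hi} → Interval N t P lo hi →
        All (λ c → Above lo c × Below hi c × c < N) Y → Served N t P lo hi (length Y) (run t Y P)
serve leaf I [] = served-nothing I
serve (node {x} {L} {R} pL pR L<x x<R) {N} {t} {P} {lo} {hi} I ((lo<x , x<hi , x<N) ∷ keys) =
  subst₂ (Served N t P lo hi) (cong suc (sym (length-++ L))) (sym (run-++ (suc t) L R (step t x P)))
    (combine served-L (serve pR (rightInterval served-L) keys-R))
  where
  open Root I x lo<x x<hi x<N
  keys-L : All (λ c → Above lo c × Below (just x) c × c < N) L
  keys-L = All.zipWith (λ { ((lo<c , _ , c<N) , c<x) → lo<c , c<x , c<N }) (proj₁ (All.++⁻ L keys) , L<x)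
  keys-R : All (λ c → Above (just x) c × Below hi c × c < N) R
  keys-R = All.zipWith (λ { ((_ , c<hi , c<N) , x<c) → x<c , c<hi , c<N }) (proj₂ (All.++⁻ L keys) , x<R)
  served-L : Served N (suc t) (step t x P) lo (just x) (length L) (run (suc t) L (step t x P))
  served-L = serve pL leftInterval keys-L

keyBound : List ℕ → ℕ
keyBound []       = 0
keyBound (a ∷ xs) = suc a + keyBound xs

keys<keyBound : ∀ xs → All (λ c → Above nothing c × Below nothing c × c < keyBound xs) xs
keys<keyBound []       = []
keys<keyBound (a ∷ xs) = (tt , tt , s≤s (m≤m+n a (keyBound xs))) ∷
  All.map (λ { (above , below , c<) → above , below , ≤-trans c< (m≤n+m (keyBound xs) (suc a)) }) (keys<keyBound xs)

initial : ∀ N → Interval N 1 [] nothing nothing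
initial N = record
  { wf           = record { t-pos = s≤s z≤n ; time-pos = λ () ; time<t = λ () ; time≤τ = λ () ; column<N = λ () }
  ; inside-empty = λ _ _ _ → refl
  ; lo-nonempty  = λ ()
  ; hi-nonempty  = λ ()
  ; beyond≤hi    = λ ()
  ; beyond≤lo    = λ () }

mainTheorem16 : (X : List ℕ) → PreOrd X → Greedy X ≤ 4 * length X
mainTheorem16 X pre = begin
  Greedy X                                      ≤⟨ m≤m+n (Greedy X) (Φ N Q) ⟩
  length Q + Φ N Q                              ≤⟨ Served.amortised served ⟩
  length {A = Point} [] + Φ N [] + 4 * length X ≡⟨ cong (_+ 4 * length X) (Φ-empty N) ⟩
  4 * length X                                  ∎
  where
  open ≤-Reasoning
  N : ℕ
  N = keyBound X
  Q : List Point
  Q = run 1 X []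
  served : Served N 1 [] nothing nothing (length X) Q
  served = serve pre (initial N) (keys<keyBound X)
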